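{- Let $\mathcal D$ be a diagram of order $t+1$. Its weak equivalence class contains exactly one complete diagram and exactly one deplete diagram.
   Context: A diagram of order $t+1$ is a tuple $(h_1,\dots,h_{t+1})$ of non-negative integers, pictured as columns $C_1,\dots,C_{t+1}$ of unit blocks stacked on the $x$-axis ($C_i$ of height $h_i$); the height of the diagram is $\max_ih_i$. Two distinct columns of height $\ge s$ are neighbours at level $s$ if every column strictly between them has height $<s$. A column $C$ is left (resp. right) extremal if it has no neighbour to its left (resp. right) at level equal to the height of $C$. Boundary conditions: every left extremal column has even height or height equal to the height of the diagram; every right extremal column has odd height or height equal to the height of the diagram. All diagrams satisfy these conditions. Adjoining a domino means adding two blocks on top of a column of height $i$; the domino is even or odd as $i$ is even or odd, and is called left (resp. right) if, in the new diagram, the enlarged column is the left (resp. right) neighbour at levels $i+1$ and $i+2$ of some column of height $\ge i+2$. The weak equivalence class of $\mathcal D$ is the set of diagrams obtainable from $\mathcal D$ by finite sequences of adjunctions of left even or right odd dominoes and of the inverse operations (removals of such dominoes). A diagram is complete if no left even or right odd domino can be adjoined to it, and deplete if no left even or right odd domino can be removed from it (i.e. it is not obtained from another diagram by adjoining such a domino). -}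

module Defs where

open import Data.Nat using (ℕ; _+_; _≤_; _<_; _⊔_)
open import Data.Nat.Divisibility using (_∣_)
open import Data.Fin as Fin using (Fin)
open import Data.Vec using (Vec; lookup; foldr; updateAt)
open import Data.Product using (Σ; ∃; _×_)
open import Data.Sum using (_⊎_)
open import Relation.Nullary using (¬_)
open import Relation.Binary.PropositionalEquality using (_≡_)
open import Relation.Binary.Construct.Closure.Equivalence using (EqClosure)

-- A diagram of order t+1 is a tuple (h_1,...,h_{t+1}) of naturals; column i has height lookup D i.

height : ∀ {n} → Vec ℕ n → ℕ
height = foldr _ _⊔_ 0

Even Odd : ℕ → Set
Even n = 2 ∣ n
Odd n = ¬ (2 ∣ n)

LeftNbr : ∀ {n} → Vec ℕ n → ℕ → Fin n → Fin n → Set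
LeftNbr D s i j =
  (i Fin.< j) × (s ≤ lookup D i) × (s ≤ lookup D j) ×
  (∀ k → i Fin.< k → k Fin.< j → lookup D k < s)

LeftExtremal : ∀ {n} → Vec ℕ n → Fin n → Set
LeftExtremal D i = ¬ (∃ λ j → LeftNbr D (lookup D i) j i)

RightExtremal : ∀ {n} → Vec ℕ n → Fin n → Set
RightExtremal D i = ¬ (∃ λ j → LeftNbr D (lookup D i) i j)

IsDiagram : ∀ {n} → Vec ℕ n → Set
IsDiagram D =
  (∀ i → LeftExtremal D i → Even (lookup D i) ⊎ lookup D i ≡ height D) ×
  (∀ i → RightExtremal D i → Odd (lookup D i) ⊎ lookup D i ≡ height D)

-- adjoin a domino (two blocks) on column i
adjoin : ∀ {n} → Vec ℕ n → Fin n → Vec ℕ n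
adjoin D i = updateAt D i (2 +_)

LeftDominoAt : ∀ {n} → Vec ℕ n → Fin n → Set
LeftDominoAt D i = let h = lookup D i ; D' = adjoin D i in
  ∃ λ j → (2 + h ≤ lookup D' j) × LeftNbr D' (1 + h) i j × LeftNbr D' (2 + h) i j

RightDominoAt : ∀ {n} → Vec ℕ n → Fin n → Set
RightDominoAt D i = let h = lookup D i ; D' = adjoin D i in
  ∃ λ j → (2 + h ≤ lookup D' j) × LeftNbr D' (1 + h) j i × LeftNbr D' (2 + h) j i

Step : ∀ {n} → Vec ℕ n → Vec ℕ n → Set
Step D E = IsDiagram D × IsDiagram E ×
  ∃ λ i → E ≡ adjoin D i ×
    ((Even (lookup D i) × LeftDominoAt D i) ⊎ (Odd (lookup D i) × RightDominoAt D i))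

WeakEq : ∀ {n} → Vec ℕ n → Vec ℕ n → Set
WeakEq = EqClosure Step

Complete : ∀ {n} → Vec ℕ n → Set
Complete D = IsDiagram D × ¬ (∃ λ E → Step D E)

Deplete : ∀ {n} → Vec ℕ n → Set
Deplete D = IsDiagram D × ¬ (∃ λ E → Step E D)

module Submission where

-- An adjunction of a left even or right odd domino at column i
-- depends only on the heights around i: writing f for the height profile, it is
-- possible iff h = f i is even and the first column to the right of i reaching
-- height h+2 exists with everything strictly between of height ≤ h (Supported in
-- direction <), or h is odd and the same holds to the left (direction >).  All
-- geometric arguments are therefore proved once, for an arbitrary strict total
-- order on the columns together with an abstract parity, and instantiated twice.
--   1. Boundary conditions are rephrased through records (columns higher than all
--      columns before them); adjoining or removing an admissible domino preserves
--      them and keeps the height of the diagram.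
--   2. Two admissible dominoes on distinct columns commute, both forwards and
--      backwards (one-step diamond properties of the step relation and of its
--      converse).
--   3. Adjunction raises the total number of blocks by 2 without changing the
--      height, so both the step relation and its converse terminate.
-- An abstract rewriting lemma (diamond ⇒ confluence ⇒ unique normal forms) then
-- yields the theorem: complete and deplete diagrams are the normal forms of the
-- step relation and of its converse.

open import Defs
open import Level using (0ℓ)
open import Function using (flip; _∘_)
open import Data.Nat using (ℕ; zero; suc; _+_; _∸_; _*_; _≤_; _<_; z≤n; s≤s)
import Data.Nat.Properties as ℕP
import Data.Nat.Induction as ℕInd
open import Data.Nat.Divisibility using (_∣_; _∣?_; divides; ∣m∣n⇒∣m+n; ∣m+n∣m⇒∣n; ∣-refl; ∣1⇒≡1)
open import Data.Fin as F using (Fin)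
import Data.Fin.Properties as FP
import Data.Fin.Induction as FInd
open import Data.Vec using (Vec; []; _∷_; lookup; updateAt; sum)
open import Data.Vec.Properties using (lookup∘updateAt; lookup∘updateAt′; updateAt-commutes; updateAt-updateAt; updateAt-id-local)
open import Data.Product using (∃; ∃!; _×_; _,_; proj₁; proj₂; map₂; uncurry)
open import Data.Sum as Sum using (_⊎_; inj₁; inj₂; [_,_]′; swap)
open import Data.Empty using (⊥-elim)
open import Induction.WellFounded using (WellFounded; Acc; acc)
open import Relation.Nullary using (¬_; Dec; yes; no)
open import Relation.Nullary.Decidable using (_×-dec_; _⊎-dec_; _→-dec_; ¬?)
open import Relation.Binary using (Rel; IsStrictTotalOrder; Tri; tri<; tri≈; tri>)
import Relation.Binary.Construct.Flip.EqAndOrd as Flip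
open import Relation.Binary.PropositionalEquality using (_≡_; _≢_; refl; sym; trans; cong; subst; subst₂; module ≡-Reasoning)
open import Relation.Binary.Construct.Closure.ReflexiveTransitive using (Star; ε; _◅_; _◅◅_)
open import Relation.Binary.Construct.Closure.Equivalence using (EqClosure; symmetric; isEquivalence; fold; return)
open import Relation.Binary.Construct.Closure.Equivalence.Properties using (a—↠b⇒a↔b)
open import Relation.Binary.Rewriting using (Confluent; IsNormalForm; conf⇒unf)

private
  variable
    n : ℕ
    a b h H : ℕ
    i j k m : Fin n
    f g d : Fin n → ℕ

even+2 : Even a → Even (2 + a)
even+2 = ∣m∣n⇒∣m+n ∣-refl

odd+2 : Odd a → Odd (2 + a)
odd+2 odd even = odd (∣m+n∣m⇒∣n even ∣-refl)

even-or-even-suc : ∀ a → Even a ⊎ Even (suc a)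
even-or-even-suc zero    = inj₁ (divides 0 refl)
even-or-even-suc (suc a) = [ inj₂ ∘ even+2 , inj₁ ]′ (even-or-even-suc a)

even-not-even-suc : Even a → ¬ Even (suc a)
even-not-even-suc {a} ea esa with ∣1⇒≡1 (∣m+n∣m⇒∣n (subst (2 ∣_) (ℕP.+-comm 1 a) esa) ea)
... | ()

odd-not-odd-suc : Odd a → ¬ Odd (suc a)
odd-not-odd-suc {a} oa osa = [ oa , osa ]′ (even-or-even-suc a)

module _ {A : Set} (_⟶_ : Rel A 0ℓ) where

  OneStepDiamond : Set
  OneStepDiamond = ∀ {a b c} → a ⟶ b → a ⟶ c → b ≡ c ⊎ ∃ λ d → b ⟶ d × c ⟶ d

  diamond⇒confluent : OneStepDiamond → Confluent _⟶_
  diamond⇒confluent diamond = confluent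
    where
    strip : ∀ {a b c} → a ⟶ b → Star _⟶_ a c → ∃ λ d → Star _⟶_ b d × Star _⟶_ c d
    strip r ε = _ , ε , r ◅ ε
    strip r (r′ ◅ rs) with diamond r r′
    ... | inj₁ refl = _ , rs , ε
    ... | inj₂ (d , bd , a′d) with strip a′d rs
    ...   | e , de , ce = e , bd ◅ de , ce
    confluent : Confluent _⟶_
    confluent ε ac = _ , ac , ε
    confluent (r ◅ rs) ac with strip r ac
    ... | d , a′d , cd with confluent rs a′d
    ...   | e , be , de = e , be , cd ◅◅ de

  normalise : (P : A → Set) → (∀ {a b} → a ⟶ b → P b) → (∀ {a} → P a → Dec (∃ (a ⟶_))) →
              (μ : A → ℕ) → (∀ {a b} → a ⟶ b → μ b < μ a) →
              ∀ {a} → P a → ∃ λ b → Star _⟶_ a b × P b × IsNormalForm _⟶_ b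
  normalise P preserved step? μ decreasing pa = reach (ℕInd.<-wellFounded _) pa
    where
    reach : ∀ {a} → Acc _<_ (μ a) → P a → ∃ λ b → Star _⟶_ a b × P b × IsNormalForm _⟶_ b
    reach {a} (acc rs) pa with step? pa
    ... | no  final      = a , ε , pa , final
    ... | yes (b , a⟶b) with reach (rs (decreasing a⟶b)) (preserved a⟶b)
    ...   | c , b↠c , pc , final = c , a⟶b ◅ b↠c , pc , final

  unique-normal-form : Confluent _⟶_ → {P : A → Set} {_≈_ : Rel A 0ℓ} →
                       (∀ {a b} → Star _⟶_ a b → a ≈ b) → (∀ {a b} → a ≈ b → EqClosure _⟶_ a b) →
                       ∀ {a} → (∃ λ b → Star _⟶_ a b × P b × IsNormalForm _⟶_ b) →
                       ∃! _≡_ λ b → a ≈ b × P b × IsNormalForm _⟶_ b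
  unique-normal-form conf reach⇒≈ ≈⇒conv (b , a↠b , pb , nf-b) =
    b , (reach⇒≈ a↠b , pb , nf-b) ,
    λ (a≈c , _ , nf-c) → conf⇒unf conf nf-b nf-c
                           (symmetric _⟶_ (≈⇒conv (reach⇒≈ a↠b)) ◅◅ ≈⇒conv a≈c)

flip-closure : ∀ {A : Set} (R : Rel A 0ℓ) {a b} → EqClosure R a b → EqClosure (flip R) a b
flip-closure R = fold (isEquivalence (flip R)) (λ r → symmetric (flip R) (return {R = flip R} r))

-- Heights are profiles f : Fin n → ℕ; all notions below are relative to an order
-- _≺_ on the columns, to be instantiated by the left-to-right order and its dual.

-- A domino on column i at height h, leaning in direction ≺: there is a column j
-- after i of height ≥ h+2 and all columns strictly between have height ≤ h.
Supported : Rel (Fin n) 0ℓ → (Fin n → ℕ) → Fin n → ℕ → Set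
Supported _≺_ f i h = ∃ λ j → i ≺ j × 2 + h ≤ f j × (∀ m → i ≺ m → m ≺ j → f m ≤ h)

Admissible : Rel (Fin n) 0ℓ → (P Q : ℕ → Set) → (Fin n → ℕ) → Fin n → ℕ → Set
Admissible _≺_ P Q f i h = (P h × Supported _≺_ f i h) ⊎ (Q h × Supported (flip _≺_) f i h)

Record : Rel (Fin n) 0ℓ → (Fin n → ℕ) → Fin n → Set
Record _≺_ f i = ∀ j → j ≺ i → f j < f i

Blocked : Rel (Fin n) 0ℓ → (Fin n → ℕ) → Fin n → Set
Blocked _≺_ f i = ∃ λ j → j ≺ i × f i ≤ f j × (∀ m → j ≺ m → m ≺ i → f m < f i)

Bounded : (ℕ → Set) → ℕ → ℕ → Set
Bounded P H x = P x ⊎ x ≡ H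

Boundary : Rel (Fin n) 0ℓ → (ℕ → Set) → (Fin n → ℕ) → ℕ → Set
Boundary _≺_ P f H = ∀ i → Record _≺_ f i → Bounded P H (f i)

Raised : (Fin n → ℕ) → Fin n → (Fin n → ℕ) → Set
Raised f i g = g i ≡ 2 + f i × (∀ m → m ≢ i → g m ≡ f m)

-- A column that is not blocked is a record: the nearest column before it that is
-- at least as high would block it.
unblocked⇒record : {_≺_ : Rel (Fin n) 0ℓ} → WellFounded (flip _≺_) →
                   ¬ Blocked _≺_ f i → Record _≺_ f i
unblocked⇒record {f = f} {i = i} {_≺_} wf unblocked j j≺i = lower j (wf j) j≺i
  where
  lower : ∀ j → Acc (flip _≺_) j → j ≺ i → f j < f i
  lower j (acc rs) j≺i with f j ℕP.<? f i
  ... | yes fj<fi = fj<fi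
  ... | no  fj≮fi = ⊥-elim (unblocked (j , j≺i , ℕP.≮⇒≥ fj≮fi ,
                      λ m j≺m m≺i → lower m (rs j≺m) m≺i))

raised-≥ : Raised f i g → ∀ m → f m ≤ g m
raised-≥ {f = f} {i = i} (gi , e) m with m FP.≟ i
... | yes refl = subst (f m ≤_) (sym gi) (ℕP.m≤n+m (f m) 2)
... | no  m≢i  = ℕP.≤-reflexive (sym (e m m≢i))

record-lower : ∀ {_⊏_ : Rel (Fin n) 0ℓ} → Raised f i g → m ≢ i →
               Record _⊏_ g m → Record _⊏_ f m
record-lower raised@(_ , e) m≢i rec p p⊏m =
  ℕP.≤-<-trans (raised-≥ raised p) (subst (_ <_) (e _ m≢i) (rec p p⊏m))

record-raise : ∀ {_⊏_ : Rel (Fin n) 0ℓ} → (∀ p → p ≢ i → g p ≡ f p) → m ≢ i →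
               (i ⊏ m → g i < g m) → Record _⊏_ f m → Record _⊏_ g m
record-raise {i = i} e m≢i new rec p p⊏m with p FP.≟ i
... | yes refl = new p⊏m
... | no  p≢i  = subst₂ _<_ (sym (e p p≢i)) (sym (e _ m≢i)) (rec p p⊏m)

boundary-raise-same : ∀ {_⊏_ : Rel (Fin n) 0ℓ} {P : ℕ → Set} →
                      (∀ {a} → P a → P (2 + a)) → Raised f i g → P (f i) →
                      Boundary _⊏_ P f H → Boundary _⊏_ P g H
boundary-raise-same {i = i} {H = H} {_⊏_} {P} P+2 raised@(gi , e) pi bnd m rec with m FP.≟ i
... | yes refl = inj₁ (subst P (sym gi) (P+2 pi))
... | no  m≢i  = subst (Bounded P H) (sym (e m m≢i)) (bnd m (record-lower {_⊏_ = _⊏_} raised m≢i rec))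

module Direction {n : ℕ} {_≺_ : Rel (Fin n) 0ℓ} (≺-sto : IsStrictTotalOrder _≡_ _≺_)
                 {P Q : ℕ → Set} (P+2 : ∀ {a} → P a → P (2 + a))
                 (P-alternates : ∀ {a} → P a → ¬ P (suc a))
                 (P-excludes-Q : ∀ {a} → P a → ¬ Q a) where

  open IsStrictTotalOrder ≺-sto using (compare; irrefl; asym) renaming (_<?_ to _≺?_; trans to ≺-trans)

  _≻_ : Rel (Fin n) 0ℓ
  _≻_ = flip _≺_

  ≺⇒≢ : i ≺ j → i ≢ j
  ≺⇒≢ i≺j refl = irrefl refl i≺j

  ≺⇒≢˘ : i ≺ j → j ≢ i
  ≺⇒≢˘ i≺j refl = irrefl refl i≺j

  supported? : ∀ f i h → Dec (Supported _≺_ f i h)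
  supported? f i h = FP.any? λ j → (i ≺? j) ×-dec (2 + h ℕP.≤? f j) ×-dec
    FP.all? (λ m → (i ≺? m) →-dec (m ≺? j) →-dec (f m ℕP.≤? h))

  supported-cong : (∀ m → m ≢ i → g m ≡ f m) → Supported _≺_ f i h → Supported _≺_ g i h
  supported-cong e (j , i≺j , hj , gap) =
    j , i≺j , subst (_ ≤_) (sym (e j (≺⇒≢˘ i≺j))) hj ,
    λ m i≺m m≺j → subst (_≤ _) (sym (e m (≺⇒≢˘ i≺m))) (gap m i≺m m≺j)

  first-record : Supported _≺_ f i (f i) → i ≺ m → Record _≺_ f m → 2 + f i ≤ f m
  first-record {m = m} (j , i≺j , hj , gap) i≺m rec with compare m j
  ... | tri< m≺j _ _ = ⊥-elim (ℕP.<⇒≱ (rec _ i≺m) (gap m i≺m m≺j))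
  ... | tri≈ _ refl _ = hj
  ... | tri> _ _ j≺m = ℕP.≤-trans hj (ℕP.<⇒≤ (rec j j≺m))

  facing-conflict : i ≺ k → (∀ m → i ≺ m → m ≺ k → f m ≤ a) → a ≤ suc b →
                    f i ≡ suc b → ¬ Supported _≻_ f k b
  facing-conflict {i = i} i≺k gap a≤1+b fi (j , j≺k , hj , gap′) with compare j i
  ... | tri< j≺i _ _ = ℕP.1+n≰n (subst (_≤ _) fi (gap′ i i≺k j≺i))
  ... | tri≈ _ refl _ = ℕP.1+n≰n (subst (_ ≤_) fi hj)
  ... | tri> _ _ i≺j = ℕP.1+n≰n (ℕP.≤-trans hj (ℕP.≤-trans (gap j i≺j j≺k) a≤1+b))

  -- Boundary conditions under adjunction of a domino supported along ≺.
  -- The raised column cannot be a record against ≺, since its support is higher.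
  boundary-raise-opposite : Raised f i g → Supported _≺_ f i (f i) →
                            Boundary _≻_ Q f H → Boundary _≻_ Q g H
  boundary-raise-opposite {i = i} {H = H} raised@(gi , e) (j , i≺j , hj , _) bnd m rec
    with m FP.≟ i
  ... | yes refl = ⊥-elim (ℕP.<⇒≱ (rec j i≺j) (subst₂ _≤_ (sym gi) (sym (e j (≺⇒≢˘ i≺j))) hj))
  ... | no  m≢i  = subst (Bounded Q H) (sym (e m m≢i)) (bnd m (record-lower {_⊏_ = _≻_} raised m≢i rec))

  -- Removing it back: a record of f other than i is a record of g, because the
  -- first record after i is at least as high as the raised column.
  boundary-lower-same : Raised f i g → P (f i) → Supported _≺_ f i (f i) →
                        Boundary _≺_ P g H → Boundary _≺_ P f H
  boundary-lower-same {f = f} {i = i} {g = g} {H = H} raised@(gi , e) pi sup bnd m rec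
    with m FP.≟ i
  ... | yes refl = inj₁ pi
  ... | no  m≢i  = by-position (compare i m)
    where
    via-record : (i ≺ m → g i < g m) → Bounded P H (f m)
    via-record new = subst (Bounded P H) (e m m≢i) (bnd m (record-raise {_⊏_ = _≺_} e m≢i new rec))
    by-position : Tri (i ≺ m) (i ≡ m) (m ≺ i) → Bounded P H (f m)
    by-position (tri≈ _ i≡m _) = ⊥-elim (m≢i (sym i≡m))
    by-position (tri> _ _ m≺i) = via-record λ i≺m → ⊥-elim (asym i≺m m≺i)
    by-position (tri< i≺m _ _) with ℕP.m≤n⇒m<n∨m≡n (first-record sup i≺m rec)
    ... | inj₁ higher = via-record λ _ → subst₂ _<_ (sym gi) (sym (e m m≢i)) higher
    ... | inj₂ same   = inj₁ (subst P same (P+2 pi))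

  -- The raised column was not a record against ≺ either; a record against ≺
  -- before i stays one, being higher than the support of i.
  boundary-lower-opposite : Raised f i g → Supported _≺_ f i (f i) →
                            Boundary _≻_ Q g H → Boundary _≻_ Q f H
  boundary-lower-opposite {f = f} {i = i} {g = g} {H = H} raised@(gi , e) (j , i≺j , hj , _) bnd m rec
    with m FP.≟ i
  ... | yes refl = ⊥-elim (ℕP.<⇒≱ (rec j i≺j) (ℕP.≤-trans (ℕP.m≤n+m (f i) 2) hj))
  ... | no  m≢i  = subst (Bounded Q H) (e m m≢i) (bnd m (record-raise {_⊏_ = _≻_} e m≢i below rec))
    where
    below : m ≺ i → g i < g m
    below m≺i = subst₂ _<_ (sym gi) (sym (e m m≢i)) (ℕP.≤-<-trans hj (rec j (≺-trans m≺i i≺j)))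

  -- Forward diamond: a domino that can be placed on i can still be placed after
  -- a domino has been placed on another column k.  Otherwise k sits in the gap of
  -- i exactly one below i, which the parity and support of k's domino exclude.
  supported-after-raise : Raised f k g → P (f i) → Supported _≺_ f i (f i) →
                          Admissible _≺_ P Q f k (f k) → Supported _≺_ g i (f i)
  supported-after-raise {f = f} {k = k} {g = g} {i = i} raised@(gk , e) pi (j , i≺j , hj , gap) adm-k
    with (i ≺? k) ×-dec (k ≺? j)
  ... | no outside = j , i≺j , ℕP.≤-trans hj (raised-≥ raised j) ,
          λ m i≺m m≺j → subst (_≤ f i) (sym (e m λ { refl → outside (i≺m , m≺j) })) (gap m i≺m m≺j)
  ... | yes (i≺k , k≺j) with 2 + f k ℕP.≤? f i
  ...   | yes low = j , i≺j , ℕP.≤-trans hj (raised-≥ raised j) , gap′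
    where
    gap′ : ∀ m → i ≺ m → m ≺ j → g m ≤ f i
    gap′ m i≺m m≺j with m FP.≟ k
    ... | yes refl = subst (_≤ f i) (sym gk) low
    ... | no  m≢k  = subst (_≤ f i) (sym (e m m≢k)) (gap m i≺m m≺j)
  ...   | no ¬low with f i ℕP.≤? f k
  ...     | yes high = k , i≺k , subst (2 + f i ≤_) (sym gk) (s≤s (s≤s high)) ,
                λ m i≺m m≺k → subst (_≤ f i) (sym (e m (≺⇒≢ m≺k))) (gap m i≺m (≺-trans m≺k k≺j))
  ...     | no ¬high = ⊥-elim (k-blocked adm-k)
    where
    fi≡1+fk : f i ≡ suc (f k)
    fi≡1+fk = ℕP.≤-antisym (ℕP.≮⇒≥ ¬low) (ℕP.≰⇒> ¬high)
    k-blocked : ¬ Admissible _≺_ P Q f k (f k)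
    k-blocked (inj₁ (pk , _))  = P-alternates pk (subst P fi≡1+fk pi)
    k-blocked (inj₂ (_ , sup)) = facing-conflict i≺k (λ m i≺m m≺k → gap m i≺m (≺-trans m≺k k≺j))
                                   (ℕP.≤-reflexive fi≡1+fk) fi≡1+fk sup

  -- Backward diamond: if d arises from g by a domino on k, and column i of d at
  -- height 2+a carries a removable domino, that domino can be placed on g.  When k
  -- is its support at the same level, k's own support takes over.
  supported-after-lower : Raised g k d → d i ≡ 2 + a → P a → Supported _≺_ d i a →
                          Admissible _≺_ P Q d k (g k) → Supported _≺_ g i a
  supported-after-lower {g = g} {k = k} {d = d} {i = i} {a = a} raised@(dk , e) di pa
                        (j , i≺j , hj , gap) adm-k with j FP.≟ k
  ... | no j≢k = j , i≺j , subst (2 + a ≤_) (e j j≢k) hj ,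
                 λ m i≺m m≺j → ℕP.≤-trans (raised-≥ raised m) (gap m i≺m m≺j)
  ... | yes refl with 2 + a ℕP.≤? g k
  ...   | yes low = k , i≺j , low , λ m i≺m m≺k → ℕP.≤-trans (raised-≥ raised m) (gap m i≺m m≺k)
  ...   | no ¬low with a ℕP.≟ g k
  ...     | yes refl = continue adm-k
    where
    continue : Admissible _≺_ P Q d k a → Supported _≺_ g i a
    continue (inj₂ (qa , _)) = ⊥-elim (P-excludes-Q pa qa)
    continue (inj₁ (_ , (j′ , k≺j′ , hj′ , gap′))) =
      j′ , ≺-trans i≺j k≺j′ , subst (2 + a ≤_) (e j′ (≺⇒≢˘ k≺j′)) hj′ , gap″
      where
      gap″ : ∀ m → i ≺ m → m ≺ j′ → g m ≤ a
      gap″ m i≺m m≺j′ with compare m k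
      ... | tri< m≺k _ _ = ℕP.≤-trans (raised-≥ raised m) (gap m i≺m m≺k)
      ... | tri≈ _ refl _ = ℕP.≤-refl
      ... | tri> _ _ k≺m = ℕP.≤-trans (raised-≥ raised m) (gap′ m k≺m m≺j′)
  ...     | no a≢gk = ⊥-elim (k-blocked adm-k)
    where
    a≤gk : a ≤ g k
    a≤gk = ℕP.+-cancelˡ-≤ 2 a (g k) (subst (2 + a ≤_) dk hj)
    gk≡1+a : g k ≡ suc a
    gk≡1+a = ℕP.≤-antisym (ℕP.≮⇒≥ ¬low) (ℕP.≤∧≢⇒< a≤gk a≢gk)
    k-blocked : ¬ Admissible _≺_ P Q d k (g k)
    k-blocked (inj₁ (pk , _))  = P-alternates pa (subst P gk≡1+a pk)
    k-blocked (inj₂ (_ , sup)) = facing-conflict i≺j gap (ℕP.m≤n⇒m≤1+n a≤gk)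
                                   (trans di (cong suc (sym gk≡1+a))) sup

-- The paper's dominoes: left even dominoes lean to the right (order <), right odd
-- dominoes lean to the left (order >).
module Left {n : ℕ} = Direction {n} FP.<-isStrictTotalOrder {Even} {Odd}
  even+2 even-not-even-suc (λ even odd → odd even)
module Right {n : ℕ} = Direction {n} (Flip.isStrictTotalOrder FP.<-isStrictTotalOrder) {Odd} {Even}
  odd+2 odd-not-odd-suc (λ odd even → odd even)

Placeable : (Fin n → ℕ) → Fin n → ℕ → Set
Placeable = Admissible F._<_ Even Odd

WellBounded : (Fin n → ℕ) → ℕ → Set
WellBounded f H = Boundary F._<_ Even f H × Boundary F._>_ Odd f H

placeable? : ∀ (f : Fin n → ℕ) i h → Dec (Placeable f i h)
placeable? f i h = ((2 ∣? h) ×-dec Left.supported? f i h) ⊎-dec (¬? (2 ∣? h) ×-dec Right.supported? f i h)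

placeable-cong : (∀ m → m ≢ i → g m ≡ f m) → Placeable f i h → Placeable g i h
placeable-cong e = Sum.map (map₂ (Left.supported-cong e)) (map₂ (Right.supported-cong e))

placeable-after-raise : Raised f k g → Placeable f i (f i) → Placeable f k (f k) → Placeable g i (f i)
placeable-after-raise r (inj₁ (ev , sup)) adm = inj₁ (ev , Left.supported-after-raise r ev sup adm)
placeable-after-raise r (inj₂ (od , sup)) adm = inj₂ (od , Right.supported-after-raise r od sup (swap adm))

placeable-after-lower : Raised g k d → d i ≡ 2 + a → Placeable d i a → Placeable d k (g k) → Placeable g i a
placeable-after-lower r di (inj₁ (ev , sup)) adm = inj₁ (ev , Left.supported-after-lower r di ev sup adm)
placeable-after-lower r di (inj₂ (od , sup)) adm = inj₂ (od , Right.supported-after-lower r di od sup (swap adm))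

wellBounded-raise : Raised f i g → Placeable f i (f i) → WellBounded f H → WellBounded g H
wellBounded-raise r (inj₁ (ev , sup)) (left , right) =
  boundary-raise-same {P = Even} even+2 r ev left , Left.boundary-raise-opposite r sup right
wellBounded-raise r (inj₂ (od , sup)) (left , right) =
  Right.boundary-raise-opposite r sup left , boundary-raise-same {P = Odd} odd+2 r od right

wellBounded-lower : Raised f i g → Placeable f i (f i) → WellBounded g H → WellBounded f H
wellBounded-lower r (inj₁ (ev , sup)) (left , right) =
  Left.boundary-lower-same r ev sup left , Left.boundary-lower-opposite r sup right
wellBounded-lower r (inj₂ (od , sup)) (left , right) =
  Right.boundary-lower-opposite r sup left , Right.boundary-lower-same r od sup right

module _ (D : Vec ℕ n) where

  leftExtremal⇒record : LeftExtremal D i → Record F._<_ (lookup D) i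
  leftExtremal⇒record ex = unblocked⇒record FInd.>-wellFounded
    λ (j , j<i , hj , gap) → ex (j , j<i , hj , ℕP.≤-refl , gap)

  rightExtremal⇒record : RightExtremal D i → Record F._>_ (lookup D) i
  rightExtremal⇒record ex = unblocked⇒record FInd.<-wellFounded
    λ (j , i<j , hj , gap) → ex (j , i<j , ℕP.≤-refl , hj , λ m i<m m<j → gap m m<j i<m)

  record⇒leftExtremal : Record F._<_ (lookup D) i → LeftExtremal D i
  record⇒leftExtremal rec (j , j<i , hj , _) = ℕP.<⇒≱ (rec j j<i) hj

  record⇒rightExtremal : Record F._>_ (lookup D) i → RightExtremal D i
  record⇒rightExtremal rec (j , i<j , _ , hj , _) = ℕP.<⇒≱ (rec j i<j) hj

  diagram⇒wellBounded : IsDiagram D → WellBounded (lookup D) (height D)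
  diagram⇒wellBounded (left , right) =
    (λ i rec → left i (record⇒leftExtremal rec)) , (λ i rec → right i (record⇒rightExtremal rec))

  wellBounded⇒diagram : WellBounded (lookup D) (height D) → IsDiagram D
  wellBounded⇒diagram (left , right) =
    (λ i ex → left i (leftExtremal⇒record ex)) , (λ i ex → right i (rightExtremal⇒record ex))

lookup≤height : ∀ (D : Vec ℕ n) i → lookup D i ≤ height D
lookup≤height (x ∷ xs) F.zero    = ℕP.m≤m⊔n x _
lookup≤height (x ∷ xs) (F.suc i) = ℕP.≤-trans (lookup≤height xs i) (ℕP.m≤n⊔m x _)

height-lub : ∀ (D : Vec ℕ n) → (∀ i → lookup D i ≤ b) → height D ≤ b
height-lub []       bound = z≤n
height-lub (x ∷ xs) bound = ℕP.⊔-lub (bound F.zero) (height-lub xs (bound ∘ F.suc))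

sum≤ : ∀ (D : Vec ℕ n) → (∀ i → lookup D i ≤ b) → sum D ≤ n * b
sum≤ []       bound = z≤n
sum≤ (x ∷ xs) bound = ℕP.+-mono-≤ (bound F.zero) (sum≤ xs (bound ∘ F.suc))

adjoin-raises : ∀ (D : Vec ℕ n) i → Raised (lookup D) i (lookup (adjoin D i))
adjoin-raises D i = lookup∘updateAt i D , λ m m≢i → lookup∘updateAt′ m i m≢i D

sum-adjoin : ∀ (D : Vec ℕ n) i → sum (adjoin D i) ≡ 2 + sum D
sum-adjoin (x ∷ xs) F.zero    = ℕP.+-assoc 2 x (sum xs)
sum-adjoin (x ∷ xs) (F.suc i) = begin
  x + sum (adjoin xs i)  ≡⟨ cong (x +_) (sum-adjoin xs i) ⟩
  x + (2 + sum xs)       ≡⟨ ℕP.+-suc x (suc (sum xs)) ⟩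
  suc (x + suc (sum xs)) ≡⟨ cong suc (ℕP.+-suc x (sum xs)) ⟩
  2 + (x + sum xs)       ∎
  where open ≡-Reasoning

placeable-support : Placeable f i h → ∃ λ j → 2 + h ≤ f j
placeable-support (inj₁ (_ , j , _ , hj , _)) = j , hj
placeable-support (inj₂ (_ , j , _ , hj , _)) = j , hj

-- A placeable domino leans on a higher column, so it does not change the height.
height-adjoin : ∀ (D : Vec ℕ n) i → Placeable (lookup D) i (lookup D i) → height (adjoin D i) ≡ height D
height-adjoin D i p = ℕP.≤-antisym (height-lub (adjoin D i) below-height)
  (height-lub D λ m → ℕP.≤-trans (raised-≥ raised m) (lookup≤height (adjoin D i) m))
  where
  raised : Raised (lookup D) i (lookup (adjoin D i))
  raised = adjoin-raises D i
  below-height : ∀ m → lookup (adjoin D i) m ≤ height D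
  below-height m with m FP.≟ i
  ... | yes refl = subst (_≤ height D) (sym (proj₁ raised))
                     (ℕP.≤-trans (proj₂ (placeable-support p)) (lookup≤height D _))
  ... | no  m≢i  = subst (_≤ height D) (sym (proj₂ raised m m≢i)) (lookup≤height D m)

remove : Vec ℕ n → Fin n → Vec ℕ n
remove D i = updateAt D i (_∸ 2)

remove-adjoin : ∀ (D : Vec ℕ n) i → remove (adjoin D i) i ≡ D
remove-adjoin D i = trans (updateAt-updateAt i D) (updateAt-id-local i D (ℕP.m+n∸m≡n 2 _))

adjoin-remove : ∀ (D : Vec ℕ n) i → 2 ≤ lookup D i → adjoin (remove D i) i ≡ D
adjoin-remove D i two≤ = trans (updateAt-updateAt i D) (updateAt-id-local i D (ℕP.m+[n∸m]≡n two≤))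

Domino : Vec ℕ n → Fin n → Set
Domino D i = (Even (lookup D i) × LeftDominoAt D i) ⊎ (Odd (lookup D i) × RightDominoAt D i)

module _ (D : Vec ℕ n) (i : Fin n) where
  private
    hᵢ = lookup D i
    D′ = adjoin D i
    top : lookup D′ i ≡ 2 + hᵢ
    top = proj₁ (adjoin-raises D i)
    outside : ∀ m → m ≢ i → lookup D′ m ≡ lookup D m
    outside = proj₂ (adjoin-raises D i)
    inside : ∀ m → m ≢ i → lookup D m ≡ lookup D′ m
    inside m m≢i = sym (outside m m≢i)

  domino⇒placeable : Domino D i → Placeable (lookup D) i hᵢ
  domino⇒placeable = Sum.map (map₂ left) (map₂ right)
    where
    left : LeftDominoAt D i → Supported F._<_ (lookup D) i hᵢ
    left (j , hj , (i<j , _ , _ , gap) , _) =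
      Left.supported-cong inside (j , i<j , hj , λ m i<m m<j → ℕP.≤-pred (gap m i<m m<j))
    right : RightDominoAt D i → Supported F._>_ (lookup D) i hᵢ
    right (j , hj , (j<i , _ , _ , gap) , _) =
      Right.supported-cong inside (j , j<i , hj , λ m m<i j<m → ℕP.≤-pred (gap m j<m m<i))

  placeable⇒domino : Placeable (lookup D) i hᵢ → Domino D i
  placeable⇒domino = Sum.map (map₂ (left ∘ Left.supported-cong outside))
                             (map₂ (right ∘ Right.supported-cong outside))
    where
    1+h≤ : 1 + hᵢ ≤ lookup D′ i
    1+h≤ = subst (1 + hᵢ ≤_) (sym top) (ℕP.n≤1+n _)
    2+h≤ : 2 + hᵢ ≤ lookup D′ i
    2+h≤ = ℕP.≤-reflexive (sym top)
    left : Supported F._<_ (lookup D′) i hᵢ → LeftDominoAt D i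
    left (j , i<j , hj , gap) =
      j , hj , (i<j , 1+h≤ , ℕP.≤-trans (ℕP.n≤1+n _) hj , λ m i<m m<j → s≤s (gap m i<m m<j)) ,
               (i<j , 2+h≤ , hj , λ m i<m m<j → s≤s (ℕP.m≤n⇒m≤1+n (gap m i<m m<j)))
    right : Supported F._>_ (lookup D′) i hᵢ → RightDominoAt D i
    right (j , j<i , hj , gap) =
      j , hj , (j<i , ℕP.≤-trans (ℕP.n≤1+n _) hj , 1+h≤ , λ m j<m m<i → s≤s (gap m m<i j<m)) ,
               (j<i , hj , 2+h≤ , λ m j<m m<i → s≤s (ℕP.m≤n⇒m≤1+n (gap m m<i j<m)))

step⇒placeable : ∀ {D E : Vec ℕ n} → Step D E → ∃ λ i → E ≡ adjoin D i × Placeable (lookup D) i (lookup D i)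
step⇒placeable {D = D} (_ , _ , i , E≡ , domino) = i , E≡ , domino⇒placeable D i domino

step-up : ∀ {D : Vec ℕ n} → IsDiagram D → Placeable (lookup D) i (lookup D i) → Step D (adjoin D i)
step-up {i = i} {D = D} dD p = dD , wellBounded⇒diagram (adjoin D i) adjoined-bounded , i , refl , placeable⇒domino D i p
  where
  adjoined-bounded : WellBounded (lookup (adjoin D i)) (height (adjoin D i))
  adjoined-bounded = subst (WellBounded _) (sym (height-adjoin D i p))
                       (wellBounded-raise (adjoin-raises D i) p (diagram⇒wellBounded D dD))

step-down : ∀ {E : Vec ℕ n} → IsDiagram E → lookup E i ≡ 2 + h → Placeable (lookup E) i h → Step (remove E i) E
step-down {i = i} {h = h} {E = E} dE Ei≡ p = subst (Step R) restored (dR , dE′ , i , refl , placeable⇒domino R i pR)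
  where
  R = remove E i
  restored : adjoin R i ≡ E
  restored = adjoin-remove E i (subst (2 ≤_) (sym Ei≡) (ℕP.m≤m+n 2 h))
  Ri≡ : lookup R i ≡ h
  Ri≡ = trans (lookup∘updateAt i E) (trans (cong (_∸ 2) Ei≡) (ℕP.m+n∸m≡n 2 h))
  pR : Placeable (lookup R) i (lookup R i)
  pR = subst (Placeable _ i) (sym Ri≡) (placeable-cong (λ m m≢i → lookup∘updateAt′ m i m≢i E) p)
  dE′ : IsDiagram (adjoin R i)
  dE′ = subst IsDiagram (sym restored) dE
  dR : IsDiagram R
  dR = wellBounded⇒diagram R (subst (WellBounded _) (height-adjoin R i pR)
         (wellBounded-lower (adjoin-raises R i) pR (diagram⇒wellBounded (adjoin R i) dE′)))

module _ {D : Vec ℕ n} where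

  step-diamond : ∀ {X Y} → Step D X → Step D Y → X ≡ Y ⊎ ∃ λ Z → Step X Z × Step Y Z
  step-diamond s@(_ , dX , _) t@(_ , dY , _) with step⇒placeable s | step⇒placeable t
  ... | x , refl , px | y , refl , py with x FP.≟ y
  ...   | yes refl = inj₁ refl
  ...   | no  x≢y  = inj₂ (adjoin (adjoin D x) y , step-up dX (still x≢y px py) ,
            subst (Step (adjoin D y)) (updateAt-commutes x y x≢y D) (step-up dY (still (x≢y ∘ sym) py px)))
    where
    still : ∀ {x y} → x ≢ y → Placeable (lookup D) x (lookup D x) → Placeable (lookup D) y (lookup D y) →
            Placeable (lookup (adjoin D x)) y (lookup (adjoin D x) y)
    still {x} {y} x≢y px py = subst (Placeable _ y) (sym (proj₂ (adjoin-raises D x) y (x≢y ∘ sym)))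
                                (placeable-after-raise (adjoin-raises D x) py px)

  removed : ∀ {X x} → D ≡ adjoin X x → X ≡ remove D x
  removed {X} {x} D≡X = sym (trans (cong (λ V → remove V x) D≡X) (remove-adjoin X x))

  raised-to : ∀ {X x} → D ≡ adjoin X x → Raised (lookup X) x (lookup D)
  raised-to {X} {x} refl = adjoin-raises X x

  removable-before : ∀ {X Y x y} → D ≡ adjoin X x → D ≡ adjoin Y y → x ≢ y →
                     Placeable (lookup X) x (lookup X x) → Placeable (lookup Y) y (lookup Y y) →
                     lookup X y ≡ 2 + lookup Y y × Placeable (lookup X) y (lookup Y y)
  removable-before {y = y} D≡X D≡Y x≢y px py =
    trans (sym (proj₂ (raised-to D≡X) y (x≢y ∘ sym))) (proj₁ (raised-to D≡Y)) ,
    placeable-after-lower (raised-to D≡X) (proj₁ (raised-to D≡Y))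
      (placeable-cong (proj₂ (raised-to D≡Y)) py) (placeable-cong (proj₂ (raised-to D≡X)) px)

  costep-diamond : ∀ {X Y} → Step X D → Step Y D → X ≡ Y ⊎ ∃ λ Z → Step Z X × Step Z Y
  costep-diamond {X} {Y} s@(dX , _) t@(dY , _) with step⇒placeable s | step⇒placeable t
  ... | x , D≡X , px | y , D≡Y , py with x FP.≟ y
  ...   | yes refl = inj₁ (trans (removed D≡X) (sym (removed D≡Y)))
  ...   | no  x≢y  = inj₂ (remove X y , uncurry (step-down dX) (removable-before D≡X D≡Y x≢y px py) ,
            subst (λ Z → Step Z Y) commute (uncurry (step-down dY) (removable-before D≡Y D≡X (x≢y ∘ sym) py px)))
    where
    commute : remove Y x ≡ remove X y
    commute = begin
      remove Y x              ≡⟨ cong (λ V → remove V x) (removed D≡Y) ⟩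
      remove (remove D y) x   ≡⟨ updateAt-commutes x y x≢y D ⟩
      remove (remove D x) y   ≡⟨ cong (λ V → remove V y) (sym (removed D≡X)) ⟩
      remove X y              ∎
      where open ≡-Reasoning

step? : ∀ {D : Vec ℕ n} → IsDiagram D → Dec (∃ (Step D))
step? {D = D} dD with FP.any? (λ i → placeable? (lookup D) i (lookup D i))
... | yes (i , p) = yes (adjoin D i , step-up dD p)
... | no  none    = no λ (_ , s) → let (i , _ , p) = step⇒placeable s in none (i , p)

removable : ∀ {D E : Vec ℕ n} → Step D E → ∃ λ i → 2 ≤ lookup E i × Placeable (lookup E) i (lookup E i ∸ 2)
removable {D = D} s with step⇒placeable s
... | i , refl , p = i , subst (2 ≤_) (sym top) (ℕP.m≤m+n 2 _) ,
      subst (Placeable _ i) (sym (trans (cong (_∸ 2) top) (ℕP.m+n∸m≡n 2 _)))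
        (placeable-cong (proj₂ (adjoin-raises D i)) p)
  where
  top : lookup (adjoin D i) i ≡ 2 + lookup D i
  top = proj₁ (adjoin-raises D i)

costep? : ∀ {E : Vec ℕ n} → IsDiagram E → Dec (∃ λ D → Step D E)
costep? {E = E} dE with FP.any? (λ i → (2 ℕP.≤? lookup E i) ×-dec placeable? (lookup E) i (lookup E i ∸ 2))
... | yes (i , 2≤ , p) = yes (remove E i , step-down dE (sym (ℕP.m+[n∸m]≡n 2≤)) p)
... | no  none         = no λ (_ , s) → none (removable s)

step-sum : ∀ {D E : Vec ℕ n} → Step D E → sum E ≡ 2 + sum D
step-sum {D = D} s with step⇒placeable s
... | i , refl , _ = sum-adjoin D i

step-height : ∀ {D E : Vec ℕ n} → Step D E → height E ≡ height D
step-height {D = D} s with step⇒placeable s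
... | i , refl , p = height-adjoin D i p

-- Number of blocks missing to fill the bounding box; it decreases along steps.
deficit : Vec ℕ n → ℕ
deficit {n} D = n * height D ∸ sum D

step-deficit : ∀ {D E : Vec ℕ n} → Step D E → deficit E < deficit D
step-deficit {n} {D} {E} s =
  subst₂ (λ H S → n * H ∸ S < deficit D) (sym (step-height s)) (sym (step-sum s))
    (ℕP.∸-monoʳ-< (ℕP.m<n+m (sum D) (s≤s z≤n)) filled)
  where
  filled : 2 + sum D ≤ n * height D
  filled = subst₂ _≤_ (step-sum s) (cong (n *_) (step-height s)) (sum≤ E (lookup≤height E))

step-sum< : ∀ {D E : Vec ℕ n} → Step D E → sum D < sum E
step-sum< {D = D} s = subst (sum D <_) (sym (step-sum s)) (ℕP.m<n+m (sum D) (s≤s z≤n))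

lemma2p3p1 : ∀ (t : ℕ) (D : Vec ℕ (suc t)) → IsDiagram D →
    (∃! _≡_ λ E → WeakEq D E × Complete E) × (∃! _≡_ λ E → WeakEq D E × Deplete E)
lemma2p3p1 t D dD =
  unique-normal-form Step (diamond⇒confluent Step step-diamond)
    a—↠b⇒a↔b (λ conv → conv) complete ,
  unique-normal-form (flip Step) (diamond⇒confluent (flip Step) costep-diamond)
    (flip-closure (flip Step) ∘ a—↠b⇒a↔b) (flip-closure Step) deplete
  where
  complete : ∃ λ E → Star Step D E × IsDiagram E × IsNormalForm Step E
  complete = normalise Step IsDiagram (proj₁ ∘ proj₂) step? deficit step-deficit dD
  deplete : ∃ λ E → Star (flip Step) D E × IsDiagram E × IsNormalForm (flip Step) E
  deplete = normalise (flip Step) IsDiagram proj₁ costep? sum step-sum< dD
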